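{- Let $n\ge1$ and let $(\sigma,\alpha)$ be a hypermap with darts $\{1,\dots,n\}$. There exists an indecomposable permutation $\theta\in\mathcal S_{n+1}$ with $\Psi(\theta)=(\sigma,\alpha)$ if and only if both of the following hold: (i) there are integers $1=i_1<i_2<\dots<i_k\le n$ such that $\sigma=(1,2,\dots,i_2-1)(i_2,i_2+1,\dots,i_3-1)\cdots(i_k,i_k+1,\dots,n)$ (cycles of consecutive integers in increasing order); (ii) the set of right-to-left minima of the sequence $\alpha^{ -1}(1),\alpha^{ -1}(2),\dots,\alpha^{ -1}(n)$ is $\{i_1,\dots,i_{k-1}\}\cup S$ for some (possibly empty) subset $S\subseteq\{i_k,i_k+1,\dots,n\}$.
   Context: Permutations are written as sequences $a_1,\dots,a_m$ with $a_i$ the image of $i$. A permutation is decomposable if there is $p<m$ with $1\le a_i\le p$ for all $i\le p$, indecomposable otherwise. $a_i$ is a left-to-right maximum if $a_j<a_i$ for all $j<i$; in a sequence $b_1,\dots,b_m$, the value $b_j$ is a right-to-left minimum if $b_j<b_l$ for all $l>j$. A hypermap with darts $\{1,\dots,n\}$ is a pair $(\sigma,\alpha)$ of permutations of $\{1,\dots,n\}$ generating a transitive group. The map $\Psi$ (algorithm OMR): given an indecomposable $\theta=a_1,\dots,a_{n+1}\in\mathcal S_{n+1}$, let $1=i_1<i_2<\dots<i_k$ be the indices of the left-to-right maxima of $\theta$ (so $a_{i_k}=n+1$); let $\sigma_1=(1,\dots,i_2-1)(i_2,\dots,i_3-1)\cdots(i_k,\dots,n+1)$; then $\alpha$ and $\sigma$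 are obtained from $\theta$ and $\sigma_1$ respectively by deleting $n+1$ from its cycle (i.e. the predecessor of $n+1$ is sent to the successor of $n+1$), and $\Psi(\theta)=(\sigma,\alpha)$. -}

module Defs where

open import Data.Nat using (ℕ; zero; suc; _≤_; _<_; _<?_; _<ᵇ_; _≡ᵇ_)
open import Data.Bool using (Bool; true; false; if_then_else_; _∧_; not)
open import Data.Fin using (Fin; toℕ; fromℕ<; inject₁; fromℕ)
open import Data.Fin.Permutation using (Permutation′; _⟨$⟩ʳ_; _⟨$⟩ˡ_)
open import Data.List using (List; []; _∷_; _++_; [_]; head)
open import Data.Bool.ListAction using (any)
open import Data.List.Relation.Unary.Linked using (Linked)
open import Data.List.Relation.Unary.All using (All)
open import Data.List.Membership.Propositional using (_∈_)
open import Data.Maybe using (just)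
open import Data.Product using (Σ; _×_; ∃)
open import Data.Sum using (_⊎_)
open import Relation.Nullary using (¬_; yes; no)
open import Relation.Binary.PropositionalEquality using (_≡_)

-- Convention: darts {1,…,m} are represented 0-based as Fin m / ℕ values 0,…,m-1.

data Reach {n : ℕ} (σ α : Permutation′ n) : Fin n → Fin n → Set where
  here  : ∀ {x} → Reach σ α x x
  stepσ  : ∀ {x y} → Reach σ α x y → Reach σ α x (σ ⟨$⟩ʳ y)
  stepσ⁻ : ∀ {x y} → Reach σ α x y → Reach σ α x (σ ⟨$⟩ˡ y)
  stepα  : ∀ {x y} → Reach σ α x y → Reach σ α x (α ⟨$⟩ʳ y)
  stepα⁻ : ∀ {x y} → Reach σ α x y → Reach σ α x (α ⟨$⟩ˡ y)

IsHypermap : {n : ℕ} → Permutation′ n → Permutation′ n → Set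
IsHypermap σ α = ∀ x y → Reach σ α x y

Decomposable : {m : ℕ} → Permutation′ m → Set
Decomposable {m} θ =
  ∃ λ (p : ℕ) → 1 ≤ p × p < m × (∀ (i : Fin m) → toℕ i < p → toℕ (θ ⟨$⟩ʳ i) < p)

Indecomposable : {m : ℕ} → Permutation′ m → Set
Indecomposable θ = ¬ Decomposable θ

-- This is the permutation (i₁,…,i₂-1)(i₂,…,i₃-1)⋯(i_k,…,m-1).

blockStart : (ℕ → Bool) → ℕ → ℕ
blockStart P zero    = zero
blockStart P (suc x) = if P (suc x) then suc x else blockStart P x

consecCycles : (ℕ → Bool) → ℕ → ℕ → ℕ
consecCycles P m x =
  if (suc x <ᵇ m) ∧ not (P (suc x)) then suc x else blockStart P x

memᵇ : List ℕ → ℕ → Bool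
memᵇ I x = any (λ y → y ≡ᵇ x) I

-- θ as a function on ℕ (arguments ≥ m are irrelevant, sent to 0)
valℕ : {m : ℕ} → Permutation′ m → ℕ → ℕ
valℕ {m} θ j with j <? m
... | yes j<m = toℕ (θ ⟨$⟩ʳ fromℕ< j<m)
... | no  _   = 0

allBelow : ℕ → (ℕ → Bool) → Bool
allBelow zero    P = true
allBelow (suc j) P = allBelow j P ∧ P j

isLRMaxᵇ : (ℕ → ℕ) → ℕ → Bool
isLRMaxᵇ g j = allBelow j (λ i → g i <ᵇ g j)

σ₁ : {n : ℕ} → Permutation′ (suc n) → ℕ → ℕ
σ₁ {n} θ = consecCycles (isLRMaxᵇ (valℕ θ)) (suc n)

-- delete the element n (0-based; i.e. n+1 in 1-based) from its cycle
deleteTop : ℕ → (ℕ → ℕ) → ℕ → ℕ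
deleteTop n f x = if f x ≡ᵇ n then f n else f x

Ψσ : {n : ℕ} → Permutation′ (suc n) → ℕ → ℕ
Ψσ {n} θ = deleteTop n (σ₁ θ)

Ψα : {n : ℕ} → Permutation′ (suc n) → ℕ → ℕ
Ψα {n} θ = deleteTop n (valℕ θ)

ΨEq : {n : ℕ} → Permutation′ (suc n) → Permutation′ n → Permutation′ n → Set
ΨEq {n} θ σ α =
  (∀ (x : Fin n) → Ψσ θ (toℕ x) ≡ toℕ (σ ⟨$⟩ʳ x)) ×
  (∀ (x : Fin n) → Ψα θ (toℕ x) ≡ toℕ (α ⟨$⟩ʳ x))

IsRLMinValue : {n : ℕ} → (Fin n → Fin n) → ℕ → Set
IsRLMinValue {n} b v =
  ∃ λ (j : Fin n) → toℕ (b j) ≡ v × (∀ (l : Fin n) → toℕ j < toℕ l → toℕ (b j) < toℕ (b l))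

-- Conditions (i) and (ii).  The integers 1 = i₁ < ⋯ < i_k ≤ n are
-- given (0-based) as the list Is ++ [ik] = i₁ ∷ ⋯ ∷ i_k.

Conditions : {n : ℕ} → Permutation′ n → Permutation′ n → Set
Conditions {n} σ α =
  Σ (List ℕ) λ Is → Σ ℕ λ ik →
    Linked _<_ (Is ++ [ ik ]) ×
    head (Is ++ [ ik ]) ≡ just 0 ×
    ik < n ×
    (∀ (x : Fin n) → toℕ (σ ⟨$⟩ʳ x) ≡ consecCycles (memᵇ (Is ++ [ ik ])) n (toℕ x)) ×
    (Σ (List ℕ) λ S →
      All (λ s → ik ≤ s × s < n) S ×
      (∀ (v : ℕ) → (IsRLMinValue (α ⟨$⟩ˡ_) v → v ∈ Is ⊎ v ∈ S) ×
                   (v ∈ Is ⊎ v ∈ S → IsRLMinValue (α ⟨$⟩ˡ_) v)))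

-- Let k be the position of the top value n in θ (darts are 0-based). Deleting n from its
-- cycle changes θ only at k, so Ψ(θ) has second component α exactly when θ is α with n
-- inserted right after k: θ k = n, θ n = α k and θ = α elsewhere. Indecomposability forces
-- k < n, as otherwise θ fixes n. The left-to-right maxima of such a θ are those of α before
-- k, then k itself (θ k = n), and none after; so Ψ(θ) has first component σ exactly when (i)
-- holds with blocks starting there. The right-to-left minima of α⁻¹ are precisely the
-- left-to-right maxima of α, which gives (ii), with S the maxima of α from k on.
--
-- Conversely, given (i) and (ii), insert n after i_k. If θ mapped a proper initial segment
-- [0, p) into itself, then p ≤ k, so α maps [0, p) into itself and, by counting, also
-- [p, n); hence p is a left-to-right maximum of α, i.e. a block start of σ, and both σ and
-- α preserve [0, p), contradicting transitivity.

module Submission where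

open import Defs
open import Data.Bool using (Bool; true; false; T)
open import Data.Bool.Properties using (T-∧; T?)
open import Data.Empty using (⊥; ⊥-elim)
open import Data.Fin as Fin using (Fin; toℕ; fromℕ<; fromℕ; inject₁; punchIn)
open import Data.Fin.Properties
  using ( toℕ-injective; toℕ<n; fromℕ<-injective; toℕ-fromℕ; toℕ-fromℕ<; fromℕ<-toℕ
        ; toℕ-inject₁; pigeonhole)
open import Data.Fin.Permutation
  using ( Permutation′; _⟨$⟩ʳ_; _⟨$⟩ˡ_; inverseˡ; inverseʳ; flip; insert; transpose; _∘ₚ_
        ; insert-punchIn)
import Data.Fin.Permutation.Components as Components
open import Data.List using (List; []; _∷_; _++_; [_]; head; filter; upTo)
open import Data.List.Membership.Propositional using (_∈_)
open import Data.List.Membership.Propositional.Properties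
  using (∈-filter⁺; ∈-filter⁻; ∈-upTo⁺; ∈-upTo⁻; ∈-++⁺ˡ; ∈-++⁺ʳ; ∈-++⁻)
open import Data.List.Relation.Unary.All as All using (All; []; _∷_)
open import Data.List.Relation.Unary.AllPairs using (AllPairs; []; _∷_)
import Data.List.Relation.Unary.AllPairs.Properties as AllPairs
open import Data.List.Relation.Unary.Any as Any using (here)
open import Data.List.Relation.Unary.Any.Properties using (any⁺; any⁻)
open import Data.List.Relation.Unary.Linked using (Linked)
open import Data.List.Relation.Unary.Linked.Properties using (AllPairs⇒Linked; Linked⇒AllPairs)
open import Data.Maybe using (just)
open import Data.Nat
open import Data.Nat.Properties
open import Data.Product using (_×_; _,_; proj₁; proj₂; ∃)
open import Data.Sum using (_⊎_; inj₁; inj₂)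
open import Data.Unit using (tt)
open import Function using (_∘_)
open import Function.Bundles using (_⇔_; mk⇔; Equivalence)
open import Function.Properties.Equivalence using () renaming (trans to ⇔-trans; sym to ⇔-sym)
open import Relation.Binary.Definitions using (tri<; tri≈; tri>)
open import Relation.Binary.PropositionalEquality
  using (_≡_; _≢_; refl; sym; trans; cong; subst; subst₂; module ≡-Reasoning)
open import Relation.Nullary using (¬_; contradiction; yes; no)
open import Relation.Nullary.Decidable using (dec-true; dec-false)

open Equivalence using (to; from)

T⇔T⇒≡ : ∀ {a b : Bool} → T a ⇔ T b → a ≡ b
T⇔T⇒≡ {false} {false} _ = refl
T⇔T⇒≡ {false} {true}  h = ⊥-elim (from h tt)
T⇔T⇒≡ {true}  {false} h = ⊥-elim (to h tt)
T⇔T⇒≡ {true}  {true}  _ = refl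

¬T⇒≡false : ∀ {b} → ¬ T b → b ≡ false
¬T⇒≡false {false} _  = refl
¬T⇒≡false {true}  ¬b = contradiction _ ¬b

T-allBelow : ∀ j P → T (allBelow j P) ⇔ (∀ {i} → i < j → T (P i))
T-allBelow j P = mk⇔ (sound j) (complete j)
  where
  sound : ∀ j → T (allBelow j P) → ∀ {i} → i < j → T (P i)
  sound (suc j) h i<1+j with to T-∧ h | m≤n⇒m<n∨m≡n (s≤s⁻¹ i<1+j)
  ... | below , _ | inj₁ i<j = sound j below i<j
  ... | _ , Pj    | inj₂ refl = Pj

  complete : ∀ j → (∀ {i} → i < j → T (P i)) → T (allBelow j P)
  complete zero    _ = _
  complete (suc j) h = from T-∧ (complete j (λ i<j → h (m<n⇒m<1+n i<j)) , h (n<1+n j))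

LeftToRightMax : (ℕ → ℕ) → ℕ → Set
LeftToRightMax g j = ∀ {i} → i < j → g i < g j

T-isLRMaxᵇ : ∀ g j → T (isLRMaxᵇ g j) ⇔ LeftToRightMax g j
T-isLRMaxᵇ g j = mk⇔
  (λ h {i} i<j → <ᵇ⇒< _ _ (to (T-allBelow j _) h i<j))
  (λ h → from (T-allBelow j _) (λ {i} i<j → <⇒<ᵇ (h i<j)))

lrMax-cong : ∀ {f g j} → (∀ {i} → i ≤ j → f i ≡ g i) → LeftToRightMax f j → LeftToRightMax g j
lrMax-cong f≗g L i<j = subst₂ _<_ (f≗g (<⇒≤ i<j)) (f≗g ≤-refl) (L i<j)

T-memᵇ : ∀ xs x → T (memᵇ xs x) ⇔ x ∈ xs
T-memᵇ xs x = mk⇔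
  (Any.map (λ {y} y≡x → sym (≡ᵇ⇒≡ y x y≡x)) ∘ any⁻ _ xs)
  (any⁺ _ ∘ Any.map (λ { refl → ≡⇒≡ᵇ x x refl }))

lrMaxima : (ℕ → ℕ) → ℕ → List ℕ
lrMaxima g m = filter (T? ∘ isLRMaxᵇ g) (upTo m)

∈-lrMaxima : ∀ g m {v} → v ∈ lrMaxima g m ⇔ (v < m × LeftToRightMax g v)
∈-lrMaxima g m {v} = mk⇔ sound complete
  where
  sound : v ∈ lrMaxima g m → v < m × LeftToRightMax g v
  sound v∈ = let v∈upTo , Lv = ∈-filter⁻ (T? ∘ isLRMaxᵇ g) v∈ in
             ∈-upTo⁻ v∈upTo , to (T-isLRMaxᵇ g v) Lv

  complete : v < m × LeftToRightMax g v → v ∈ lrMaxima g m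
  complete (v<m , Lv) = ∈-filter⁺ (T? ∘ isLRMaxᵇ g) (∈-upTo⁺ v<m) (from (T-isLRMaxᵇ g v) Lv)

lrMaxima-linked : ∀ g k → Linked _<_ (lrMaxima g k ++ [ k ])
lrMaxima-linked g k = AllPairs⇒Linked
  (AllPairs.++⁺ (AllPairs.filter⁺ (T? ∘ isLRMaxᵇ g) (AllPairs.applyUpTo⁺₁ _ k (λ i<j _ → i<j)))
                ([] ∷ [])
                (All.tabulate (λ v∈ → proj₁ (to (∈-lrMaxima g k) v∈) ∷ [])))

-- position 0 is vacuously a left-to-right maximum, so it heads the list
lrMaxima-head : ∀ g k → head (lrMaxima g k ++ [ k ]) ≡ just 0
lrMaxima-head g zero    = refl
lrMaxima-head g (suc k) = refl

sorted-last : ∀ xs {k} → AllPairs _<_ (xs ++ [ k ]) → All (_< k) xs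
sorted-last []       _            = []
sorted-last (x ∷ xs) (x<ys ∷ ys<) = All.lookup x<ys (∈-++⁺ʳ xs (here refl)) ∷ sorted-last xs ys<

blockStart-≤ : ∀ P x → blockStart P x ≤ x
blockStart-≤ P zero = z≤n
blockStart-≤ P (suc x) with P (suc x)
... | true  = ≤-refl
... | false = m≤n⇒m≤1+n (blockStart-≤ P x)

blockStart-cong : ∀ {P Q} x → (∀ {j} → j ≤ x → P j ≡ Q j) → blockStart P x ≡ blockStart Q x
blockStart-cong zero    _     = refl
blockStart-cong {P} {Q} (suc x) P≗Q rewrite P≗Q ≤-refl with Q (suc x)
... | true  = refl
... | false = blockStart-cong x (λ j≤x → P≗Q (m≤n⇒m≤1+n j≤x))

blockStart-skip : ∀ P x → ¬ T (P (suc x)) → blockStart P (suc x) ≡ blockStart P x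
blockStart-skip P x ¬P rewrite ¬T⇒≡false ¬P = refl

consecCycles-cases : ∀ Q m x →
  (¬ T (Q (suc x)) × consecCycles Q m x ≡ suc x) ⊎ consecCycles Q m x ≡ blockStart Q x
consecCycles-cases Q m x with suc x <ᵇ m | Q (suc x)
... | true  | false = inj₁ ((λ ()) , refl)
... | true  | true  = inj₂ refl
... | false | _     = inj₂ refl

consecCycles-< : ∀ Q m {p} x → T (Q p) → x < p → consecCycles Q m x < p
consecCycles-< Q m x Qp x<p with consecCycles-cases Q m x
... | inj₁ (¬Q , eq) rewrite eq = ≤∧≢⇒< x<p (λ { refl → ¬Q Qp })
... | inj₂ eq        rewrite eq = ≤-<-trans (blockStart-≤ Q x) x<p

consecCycles-next : ∀ Q {m} x → suc x < m → ¬ T (Q (suc x)) → consecCycles Q m x ≡ suc x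
consecCycles-next Q {m} x 1+x<m ¬Q rewrite dec-true (suc x <? m) 1+x<m | ¬T⇒≡false ¬Q = refl

consecCycles-end : ∀ Q {m} x → ¬ suc x < m → consecCycles Q m x ≡ blockStart Q x
consecCycles-end Q {m} x 1+x≮m rewrite dec-false (suc x <? m) 1+x≮m = refl

consecCycles-≤ : ∀ Q m x → consecCycles Q m x ≤ suc x
consecCycles-≤ Q m x with consecCycles-cases Q m x
... | inj₁ (_ , eq) rewrite eq = ≤-refl
... | inj₂ eq       rewrite eq = m≤n⇒m≤1+n (blockStart-≤ Q x)

deleteTop-≢ : ∀ n f x → f x ≢ n → deleteTop n f x ≡ f x
deleteTop-≢ n f x fx≢n rewrite dec-false (f x ≟ n) fx≢n = refl

deleteTop-≡ : ∀ n f x → f x ≡ n → deleteTop n f x ≡ f n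
deleteTop-≡ n f x fx≡n rewrite dec-true (f x ≟ n) fx≡n = refl

module _ {P Q : ℕ → Bool} (n : ℕ) (P≗Q : ∀ {j} → j < n → P j ≡ Q j) where

  consecCycles-extend : ∀ {x} → suc x < n → consecCycles P (suc n) x ≡ consecCycles Q n x
  consecCycles-extend {x} 1+x<n
    rewrite dec-true (suc x <? suc n) (m<n⇒m<1+n 1+x<n) | dec-true (suc x <? n) 1+x<n | P≗Q 1+x<n
          | blockStart-cong {P} {Q} x (λ j≤x → P≗Q (≤-<-trans j≤x (<-trans (n<1+n x) 1+x<n)))
    = refl

  deleteTop-consecCycles : ¬ T (P n) → ∀ {x} → x < n →
    deleteTop n (consecCycles P (suc n)) x ≡ consecCycles Q n x
  deleteTop-consecCycles ¬Pn {x} x<n with m≤n⇒m<n∨m≡n x<n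
  ... | inj₁ 1+x<n = trans
    (deleteTop-≢ n (consecCycles P (suc n)) x (<⇒≢ (≤-<-trans (consecCycles-≤ P (suc n) x) 1+x<n)))
    (consecCycles-extend 1+x<n)
  ... | inj₂ refl = begin
    deleteTop (suc x) (consecCycles P (2+ x)) x
      ≡⟨ deleteTop-≡ (suc x) (consecCycles P (2+ x)) x (consecCycles-next P x ≤-refl ¬Pn) ⟩
    consecCycles P (2+ x) (suc x)               ≡⟨ consecCycles-end P (suc x) (n≮n _) ⟩
    blockStart P (suc x)                        ≡⟨ blockStart-skip P x ¬Pn ⟩
    blockStart P x                              ≡⟨ blockStart-cong x (λ j≤x → P≗Q (s≤s j≤x)) ⟩
    blockStart Q x                              ≡⟨ consecCycles-end Q x (n≮n _) ⟨
    consecCycles Q (suc x) x                    ∎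
    where open ≡-Reasoning

module _ {m} (π : Permutation′ m) where

  valℕ-toℕ : ∀ x → valℕ π (toℕ x) ≡ toℕ (π ⟨$⟩ʳ x)
  valℕ-toℕ x with toℕ x <? m
  ... | yes x<m  = cong (λ y → toℕ (π ⟨$⟩ʳ y)) (fromℕ<-toℕ x x<m)
  ... | no  x≮m = contradiction (toℕ<n x) x≮m

  valℕ-fromℕ< : ∀ {x} (x<m : x < m) → valℕ π x ≡ toℕ (π ⟨$⟩ʳ fromℕ< x<m)
  valℕ-fromℕ< {x} x<m = trans (cong (valℕ π) (sym (toℕ-fromℕ< x<m))) (valℕ-toℕ (fromℕ< x<m))

  valℕ-< : ∀ {x} → x < m → valℕ π x < m
  valℕ-< x<m rewrite valℕ-fromℕ< x<m = toℕ<n _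

  ⟨$⟩ʳ-injective : ∀ {x y} → π ⟨$⟩ʳ x ≡ π ⟨$⟩ʳ y → x ≡ y
  ⟨$⟩ʳ-injective eq = trans (sym (inverseˡ π)) (trans (cong (π ⟨$⟩ˡ_) eq) (inverseˡ π))

  valℕ-injective : ∀ {x y} → x < m → y < m → valℕ π x ≡ valℕ π y → x ≡ y
  valℕ-injective x<m y<m eq
    rewrite valℕ-fromℕ< x<m | valℕ-fromℕ< y<m
    = trans (sym (toℕ-fromℕ< x<m))
            (trans (cong toℕ (⟨$⟩ʳ-injective (toℕ-injective eq))) (toℕ-fromℕ< y<m))

Stable : ∀ {n} → (Fin n → Fin n) → ℕ → Set
Stable f p = ∀ x → toℕ x < p → toℕ (f x) < p

module _ {n} (π : Permutation′ n) {p} (stable : Stable (π ⟨$⟩ʳ_) p) where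

  -- π would map the p + 1 darts 0, …, p - 1, x injectively into [0, p).
  private
    module Escape (x : Fin n) (p≤x : p ≤ toℕ x) (πx<p : toℕ (π ⟨$⟩ʳ x) < p) where

      p<n : p < n
      p<n = ≤-<-trans p≤x (toℕ<n x)

      segment : Fin (suc p) → Fin n
      segment j with toℕ j <? p
      ... | yes j<p = fromℕ< (<-trans j<p p<n)
      ... | no  _   = x

      toℕ-segment : ∀ j → toℕ j < p → toℕ (segment j) ≡ toℕ j
      toℕ-segment j j<p with toℕ j <? p
      ... | yes _   = toℕ-fromℕ< _
      ... | no  j≮p = contradiction j<p j≮p

      segment-last : ∀ j → ¬ toℕ j < p → segment j ≡ x
      segment-last j j≮p with toℕ j <? p
      ... | yes j<p = contradiction j<p j≮p
      ... | no  _   = refl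

      segment-stable : ∀ j → toℕ (π ⟨$⟩ʳ segment j) < p
      segment-stable j with toℕ j <? p
      ... | yes j<p = stable _ (subst (_< p) (sym (toℕ-fromℕ< _)) j<p)
      ... | no  _   = πx<p

      collision : ∀ i j → toℕ i < toℕ j → segment i ≡ segment j → ⊥
      collision i j i<j eq with m≤n⇒m<n∨m≡n (s≤s⁻¹ (toℕ<n j))
      ... | inj₁ j<p = <-irrefl (begin
        toℕ i           ≡⟨ toℕ-segment i (<-trans i<j j<p) ⟨
        toℕ (segment i) ≡⟨ cong toℕ eq ⟩
        toℕ (segment j) ≡⟨ toℕ-segment j j<p ⟩
        toℕ j           ∎) i<j
        where open ≡-Reasoning
      ... | inj₂ j≡p = <⇒≱ (subst (_< p) (sym x≡i) i<p) p≤x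
        where
        i<p = <-≤-trans i<j (≤-reflexive j≡p)
        x≡i : toℕ x ≡ toℕ i
        x≡i = trans (cong toℕ (trans (sym (segment-last j (λ j<p → <-irrefl j≡p j<p))) (sym eq)))
                    (toℕ-segment i i<p)

      absurd : ⊥
      absurd with pigeonhole (n<1+n p) (λ j → fromℕ< (segment-stable j))
      ... | i , j , i<j , eq =
        collision i j i<j (⟨$⟩ʳ-injective π (toℕ-injective (fromℕ<-injective _ _ _ _ eq)))

  stable-complement : ∀ x → p ≤ toℕ x → p ≤ toℕ (π ⟨$⟩ʳ x)
  stable-complement x p≤x with p ≤? toℕ (π ⟨$⟩ʳ x)
  ... | yes p≤πx = p≤πx
  ... | no  p≰πx = ⊥-elim (Escape.absurd x p≤x (≰⇒> p≰πx))

  stable-inverse : Stable (π ⟨$⟩ˡ_) p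
  stable-inverse y y<p with p ≤? toℕ (π ⟨$⟩ˡ y)
  ... | no  p≰π⁻¹y = ≰⇒> p≰π⁻¹y
  ... | yes p≤π⁻¹y =
    contradiction (subst (p ≤_) (cong toℕ (inverseʳ π)) (stable-complement _ p≤π⁻¹y)) (<⇒≱ y<p)

module _ {n} {σ α : Permutation′ n} {p}
         (σ-stable : Stable (σ ⟨$⟩ʳ_) p) (α-stable : Stable (α ⟨$⟩ʳ_) p) where

  reach-stable : ∀ {x y} → Reach σ α x y → toℕ x < p → toℕ y < p
  reach-stable here        x<p = x<p
  reach-stable (stepσ r)  x<p = σ-stable _ (reach-stable r x<p)
  reach-stable (stepσ⁻ r) x<p = stable-inverse σ σ-stable _ (reach-stable r x<p)
  reach-stable (stepα r)  x<p = α-stable _ (reach-stable r x<p)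
  reach-stable (stepα⁻ r) x<p = stable-inverse α α-stable _ (reach-stable r x<p)

  hypermap-unstable : IsHypermap σ α → 0 < p → p < n → ⊥
  hypermap-unstable transitive 0<p p<n =
    <-irrefl (toℕ-fromℕ< p<n) (reach-stable (transitive first (fromℕ< p<n)) first<p)
    where
    first = fromℕ< (<-trans 0<p p<n)
    first<p = subst (_< p) (sym (toℕ-fromℕ< _)) 0<p

module _ {n} (α : Permutation′ n) (j : Fin n) where

  rightMin⇒leftMax : (∀ l → toℕ j < toℕ l → toℕ (α ⟨$⟩ˡ j) < toℕ (α ⟨$⟩ˡ l)) →
                     ∀ u → toℕ u < toℕ (α ⟨$⟩ˡ j) → toℕ (α ⟨$⟩ʳ u) < toℕ j
  rightMin⇒leftMax rightMin u u<α⁻¹j with <-cmp (toℕ (α ⟨$⟩ʳ u)) (toℕ j)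
  ... | tri< αu<j _ _ = αu<j
  ... | tri≈ _ αu≡j _ =
    ⊥-elim (<-irrefl (cong toℕ (⟨$⟩ʳ-injective α (trans (toℕ-injective αu≡j) (sym (inverseʳ α)))))
                     u<α⁻¹j)
  ... | tri> _ _ j<αu =
    ⊥-elim (<-asym u<α⁻¹j (subst (λ w → toℕ (α ⟨$⟩ˡ j) < toℕ w) (inverseˡ α) (rightMin _ j<αu)))

  leftMax⇒rightMin : (∀ u → toℕ u < toℕ (α ⟨$⟩ˡ j) → toℕ (α ⟨$⟩ʳ u) < toℕ j) →
                     ∀ l → toℕ j < toℕ l → toℕ (α ⟨$⟩ˡ j) < toℕ (α ⟨$⟩ˡ l)
  leftMax⇒rightMin leftMax l j<l with <-cmp (toℕ (α ⟨$⟩ˡ l)) (toℕ (α ⟨$⟩ˡ j))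
  ... | tri< α⁻¹l<α⁻¹j _ _ =
    ⊥-elim (<-asym j<l (subst (λ w → toℕ w < toℕ j) (inverseʳ α) (leftMax _ α⁻¹l<α⁻¹j)))
  ... | tri≈ _ α⁻¹l≡α⁻¹j _ =
    ⊥-elim (<-irrefl (cong toℕ (sym (⟨$⟩ʳ-injective (flip α) (toℕ-injective α⁻¹l≡α⁻¹j)))) j<l)
  ... | tri> _ _ α⁻¹j<α⁻¹l = α⁻¹j<α⁻¹l

lrMax-valℕ : ∀ {n} (π : Permutation′ n) (v : Fin n) →
  LeftToRightMax (valℕ π) (toℕ v) ⇔ (∀ u → toℕ u < toℕ v → toℕ (π ⟨$⟩ʳ u) < toℕ (π ⟨$⟩ʳ v))
lrMax-valℕ π v = mk⇔ onFin onℕ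
  where
  onFin : LeftToRightMax (valℕ π) (toℕ v) →
          ∀ u → toℕ u < toℕ v → toℕ (π ⟨$⟩ʳ u) < toℕ (π ⟨$⟩ʳ v)
  onFin L u u<v = subst₂ _<_ (valℕ-toℕ π u) (valℕ-toℕ π v) (L u<v)

  onℕ : (∀ u → toℕ u < toℕ v → toℕ (π ⟨$⟩ʳ u) < toℕ (π ⟨$⟩ʳ v)) →
        LeftToRightMax (valℕ π) (toℕ v)
  onℕ H {i} i<v = subst₂ _<_ (sym (valℕ-fromℕ< π i<n)) (sym (valℕ-toℕ π v))
    (H (fromℕ< i<n) (subst (_< toℕ v) (sym (toℕ-fromℕ< i<n)) i<v))
    where i<n = <-trans i<v (toℕ<n v)

rlMin⇔lrMax : ∀ {n} (α : Permutation′ n) v →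
  IsRLMinValue (α ⟨$⟩ˡ_) v ⇔ (v < n × LeftToRightMax (valℕ α) v)
rlMin⇔lrMax {n} α v = mk⇔ sound complete
  where
  sound : IsRLMinValue (α ⟨$⟩ˡ_) v → v < n × LeftToRightMax (valℕ α) v
  sound (j , refl , rightMin) = toℕ<n _ , from (lrMax-valℕ α (α ⟨$⟩ˡ j))
    (λ u u<v → subst (λ w → toℕ (α ⟨$⟩ʳ u) < toℕ w) (sym (inverseʳ α))
                     (rightMin⇒leftMax α j rightMin u u<v))

  complete : v < n × LeftToRightMax (valℕ α) v → IsRLMinValue (α ⟨$⟩ˡ_) v
  complete (v<n , L) = α ⟨$⟩ʳ V , trans (cong toℕ (inverseˡ α)) (toℕ-fromℕ< v<n) ,
    leftMax⇒rightMin α (α ⟨$⟩ʳ V)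
      (λ u u<α⁻¹αV → to (lrMax-valℕ α V) L′ u (subst (λ w → toℕ u < toℕ w) (inverseˡ α) u<α⁻¹αV))
    where
    V = fromℕ< v<n
    L′ = subst (LeftToRightMax (valℕ α)) (sym (toℕ-fromℕ< v<n)) L

valℕ-below-top : ∀ {n} (θ : Permutation′ (suc n)) {k x} → k ≤ n → valℕ θ k ≡ n →
  x ≤ n → x ≢ k → valℕ θ x < n
valℕ-below-top θ k≤n θk≡n x≤n x≢k = ≤∧≢⇒< (s≤s⁻¹ (valℕ-< θ (s≤s x≤n)))
  (λ θx≡n → x≢k (valℕ-injective θ (s≤s x≤n) (s≤s k≤n) (trans θx≡n (sym θk≡n))))

-- θ arises from α by inserting the new top dart n right after k in its cycle.
record InsertsTop {n} (k : ℕ) (α : Permutation′ n) (θ : Permutation′ (suc n)) : Set where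
  field
    k<n   : k < n
    θ-k   : valℕ θ k ≡ n
    θ-top : valℕ θ n ≡ valℕ α k
    θ-α   : ∀ {x} → x < n → x ≢ k → valℕ θ x ≡ valℕ α x

module _ {n k} {α : Permutation′ n} {θ : Permutation′ (suc n)} (ins : InsertsTop k α θ) where
  open InsertsTop ins

  θ-α-below : ∀ {x} → x < k → valℕ θ x ≡ valℕ α x
  θ-α-below x<k = θ-α (<-trans x<k k<n) (<⇒≢ x<k)

  θ-below-top : ∀ {x} → x ≤ n → x ≢ k → valℕ θ x < n
  θ-below-top = valℕ-below-top θ (<⇒≤ k<n) θ-k

  insertsTop⇒Ψα : ∀ x → Ψα θ (toℕ x) ≡ toℕ (α ⟨$⟩ʳ x)
  insertsTop⇒Ψα x with toℕ x ≟ k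
  ... | yes refl = trans (deleteTop-≡ n (valℕ θ) (toℕ x) θ-k) (trans θ-top (valℕ-toℕ α x))
  ... | no  x≢k  =
    trans (deleteTop-≢ n (valℕ θ) (toℕ x) (<⇒≢ (θ-below-top (<⇒≤ (toℕ<n x)) x≢k)))
          (trans (θ-α (toℕ<n x) x≢k) (valℕ-toℕ α x))

  lrMax-insertsTop : ∀ {j} → j ≤ n →
    LeftToRightMax (valℕ θ) j ⇔ ((j < k × LeftToRightMax (valℕ α) j) ⊎ j ≡ k)
  lrMax-insertsTop {j} j≤n = mk⇔ forward backward
    where
    forward : LeftToRightMax (valℕ θ) j → (j < k × LeftToRightMax (valℕ α) j) ⊎ j ≡ k
    forward L with <-cmp j k
    ... | tri< j<k _ _ = inj₁ (j<k , lrMax-cong (λ i≤j → θ-α-below (≤-<-trans i≤j j<k)) L)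
    ... | tri≈ _ j≡k _ = inj₂ j≡k
    ... | tri> _ _ k<j =
      ⊥-elim (<⇒≱ (subst (_< valℕ θ j) θ-k (L k<j)) (s≤s⁻¹ (valℕ-< θ (s≤s j≤n))))

    backward : (j < k × LeftToRightMax (valℕ α) j) ⊎ j ≡ k → LeftToRightMax (valℕ θ) j
    backward (inj₁ (j<k , L)) = lrMax-cong (λ i≤j → sym (θ-α-below (≤-<-trans i≤j j<k))) L
    backward (inj₂ refl) {i} i<k =
      subst (valℕ θ i <_) (sym θ-k) (θ-below-top (<⇒≤ (<-≤-trans i<k j≤n)) (<⇒≢ i<k))

  module _ {Is : List ℕ} (Is<k : All (_< k) Is)
           (Is⇔ : ∀ {j} → j < k → j ∈ Is ⇔ LeftToRightMax (valℕ α) j) where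

    ∈-blockStarts : ∀ {j} → ((j < k × LeftToRightMax (valℕ α) j) ⊎ j ≡ k) ⇔ j ∈ Is ++ [ k ]
    ∈-blockStarts {j} = mk⇔ sound complete
      where
      sound : (j < k × LeftToRightMax (valℕ α) j) ⊎ j ≡ k → j ∈ Is ++ [ k ]
      sound (inj₁ (j<k , L)) = ∈-++⁺ˡ (from (Is⇔ j<k) L)
      sound (inj₂ refl)      = ∈-++⁺ʳ Is (here refl)

      complete : j ∈ Is ++ [ k ] → (j < k × LeftToRightMax (valℕ α) j) ⊎ j ≡ k
      complete j∈ with ∈-++⁻ Is j∈
      ... | inj₁ j∈Is       = inj₁ (All.lookup Is<k j∈Is , to (Is⇔ (All.lookup Is<k j∈Is)) j∈Is)
      ... | inj₂ (here j≡k) = inj₂ j≡k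

    Ψσ-insertsTop : ∀ {x} → x < n → Ψσ θ x ≡ consecCycles (memᵇ (Is ++ [ k ])) n x
    Ψσ-insertsTop = deleteTop-consecCycles n agree top-not-start
      where
      agree : ∀ {j} → j < n → isLRMaxᵇ (valℕ θ) j ≡ memᵇ (Is ++ [ k ]) j
      agree {j} j<n = T⇔T⇒≡
        (⇔-trans (T-isLRMaxᵇ (valℕ θ) j)
        (⇔-trans (lrMax-insertsTop (<⇒≤ j<n))
        (⇔-trans ∈-blockStarts
                 (⇔-sym (T-memᵇ _ j)))))

      top-not-start : ¬ T (isLRMaxᵇ (valℕ θ) n)
      top-not-start Tn with to (lrMax-insertsTop ≤-refl) (to (T-isLRMaxᵇ (valℕ θ) n) Tn)
      ... | inj₁ (n<k , _) = <-asym n<k k<n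
      ... | inj₂ n≡k       = <-irrefl (sym n≡k) k<n

  insertsTop-indecomposable : ∀ {σ} {Is : List ℕ} → IsHypermap σ α →
    (∀ {j} → j < k → LeftToRightMax (valℕ α) j → j ∈ Is) →
    (∀ x → toℕ (σ ⟨$⟩ʳ x) ≡ consecCycles (memᵇ (Is ++ [ k ])) n (toℕ x)) →
    Indecomposable θ
  insertsTop-indecomposable {σ} {Is} transitive lrMax⇒∈Is σ-blocks (p , 1≤p , p<1+n , θ-stable) =
    hypermap-unstable σ-stable α-stable transitive 1≤p p<n
    where
    θ-stableℕ : ∀ {x} → x < p → valℕ θ x < p
    θ-stableℕ x<p = subst (_< _) (sym (valℕ-fromℕ< θ x<1+n))
      (θ-stable _ (subst (_< _) (sym (toℕ-fromℕ< x<1+n)) x<p))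
      where x<1+n = <-trans x<p p<1+n

    p≤k : p ≤ k
    p≤k = ≮⇒≥ (λ k<p → <⇒≱ (subst (_< p) θ-k (θ-stableℕ k<p)) (s≤s⁻¹ p<1+n))

    p<n : p < n
    p<n = ≤-<-trans p≤k k<n

    α-stable : Stable (α ⟨$⟩ʳ_) p
    α-stable x x<p =
      subst (_< p) (trans (θ-α-below (<-≤-trans x<p p≤k)) (valℕ-toℕ α x)) (θ-stableℕ x<p)

    p-lrMax : LeftToRightMax (valℕ α) p
    p-lrMax {i} i<p = <-≤-trans (subst (_< p) (θ-α-below (<-≤-trans i<p p≤k)) (θ-stableℕ i<p))
      (subst (p ≤_) (sym (valℕ-fromℕ< α p<n))
        (stable-complement α α-stable (fromℕ< p<n) (≤-reflexive (sym (toℕ-fromℕ< p<n)))))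

    p-starts : T (memᵇ (Is ++ [ k ]) p)
    p-starts with m≤n⇒m<n∨m≡n p≤k
    ... | inj₁ p<k = from (T-memᵇ _ p) (∈-++⁺ˡ (lrMax⇒∈Is p<k p-lrMax))
    ... | inj₂ refl = from (T-memᵇ _ p) (∈-++⁺ʳ Is (here refl))

    σ-stable : Stable (σ ⟨$⟩ʳ_) p
    σ-stable x x<p = subst (_< p) (sym (σ-blocks x)) (consecCycles-< _ n (toℕ x) p-starts x<p)

Ψα⇒insertsTop : ∀ {n} {α : Permutation′ n} {θ : Permutation′ (suc n)} → 1 ≤ n →
  Indecomposable θ → (∀ x → Ψα θ (toℕ x) ≡ toℕ (α ⟨$⟩ʳ x)) →
  InsertsTop (toℕ (θ ⟨$⟩ˡ fromℕ n)) α θ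
Ψα⇒insertsTop {n} {α} {θ} 1≤n indecomposable Ψα≡α = record
  { k<n   = k<n
  ; θ-k   = θ-k
  ; θ-top = trans (sym (deleteTop-≡ n (valℕ θ) k θ-k)) (Ψα≡αℕ k<n)
  ; θ-α   = θ-α
  }
  where
  k = toℕ (θ ⟨$⟩ˡ fromℕ n)

  θ-k : valℕ θ k ≡ n
  θ-k = trans (valℕ-toℕ θ _) (trans (cong toℕ (inverseʳ θ)) (toℕ-fromℕ n))

  below-top : ∀ {x} → x ≤ n → x ≢ k → valℕ θ x < n
  below-top = valℕ-below-top θ (s≤s⁻¹ (toℕ<n _)) θ-k

  -- if θ fixed the top dart, [0, n) would be a proper stable block
  k<n : k < n
  k<n = ≤∧≢⇒< (s≤s⁻¹ (toℕ<n _)) λ k≡n → indecomposable (n , 1≤n , n<1+n n ,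
    λ i i<n → subst (_< n) (valℕ-toℕ θ i)
                    (below-top (<⇒≤ i<n) (λ i≡k → <-irrefl (trans i≡k k≡n) i<n)))

  Ψα≡αℕ : ∀ {x} → x < n → Ψα θ x ≡ valℕ α x
  Ψα≡αℕ x<n =
    trans (cong (Ψα θ) (sym (toℕ-fromℕ< x<n))) (trans (Ψα≡α _) (sym (valℕ-fromℕ< α x<n)))

  θ-α : ∀ {x} → x < n → x ≢ k → valℕ θ x ≡ valℕ α x
  θ-α {x} x<n x≢k =
    trans (sym (deleteTop-≢ n (valℕ θ) x (<⇒≢ (below-top (<⇒≤ x<n) x≢k)))) (Ψα≡αℕ x<n)

punchIn-fromℕ : ∀ n (y : Fin n) → punchIn (fromℕ n) y ≡ inject₁ y
punchIn-fromℕ (suc n) Fin.zero    = refl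
punchIn-fromℕ (suc n) (Fin.suc y) = cong Fin.suc (punchIn-fromℕ n y)

module _ {m} (i j : Fin m) where

  transpose-ˡ : Components.transpose i j i ≡ j
  transpose-ˡ rewrite dec-true (i Fin.≟ i) refl = refl

  transpose-ʳ : Components.transpose i j j ≡ i
  transpose-ʳ with j Fin.≟ i
  ... | yes refl = refl
  ... | no  _ rewrite dec-true (j Fin.≟ j) refl = refl

  transpose-≢ : ∀ {x} → x ≢ i → x ≢ j → Components.transpose i j x ≡ x
  transpose-≢ {x} x≢i x≢j rewrite dec-false (x Fin.≟ i) x≢i | dec-false (x Fin.≟ j) x≢j = refl

module _ {n} (α : Permutation′ n) {k} (k<n : k < n) where
  private
    top : Fin (suc n)
    top = fromℕ n

    embed : ∀ {x} → x < n → Fin (suc n)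
    embed x<n = fromℕ< (m<n⇒m<1+n x<n)

    K : Fin (suc n)
    K = embed k<n

    α⁺ : Permutation′ (suc n)
    α⁺ = insert top top α

    -- _∘ₚ_ is diagrammatic: θ first swaps K with top, then applies α⁺.
    θ : Permutation′ (suc n)
    θ = transpose K top ∘ₚ α⁺

    swap : Fin (suc n) → Fin (suc n)
    swap = Components.transpose K top

    valℕ-θ : ∀ {x} (x<1+n : x < suc n) → valℕ θ x ≡ toℕ (α⁺ ⟨$⟩ʳ swap (fromℕ< x<1+n))
    valℕ-θ = valℕ-fromℕ< θ

    cong-α⁺ : ∀ {y z} → y ≡ z → toℕ (α⁺ ⟨$⟩ʳ y) ≡ toℕ (α⁺ ⟨$⟩ʳ z)
    cong-α⁺ = cong (λ y → toℕ (α⁺ ⟨$⟩ʳ y))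

    embed≡inject₁ : ∀ {x} (x<n : x < n) → embed x<n ≡ inject₁ (fromℕ< x<n)
    embed≡inject₁ x<n =
      toℕ-injective (trans (toℕ-fromℕ< _) (sym (trans (toℕ-inject₁ _) (toℕ-fromℕ< x<n))))

    embed≢top : ∀ {x} (x<n : x < n) → embed x<n ≢ top
    embed≢top x<n eq = <-irrefl (trans (sym (toℕ-fromℕ< _)) (trans (cong toℕ eq) (toℕ-fromℕ n))) x<n

    n≡top : fromℕ< (n<1+n n) ≡ top
    n≡top = toℕ-injective (trans (toℕ-fromℕ< _) (sym (toℕ-fromℕ n)))

    α⁺-top : α⁺ ⟨$⟩ʳ top ≡ top
    α⁺-top with top Fin.≟ top
    ... | yes _    = refl
    ... | no  ≢top = contradiction refl ≢top

    α⁺-embed : ∀ {x} (x<n : x < n) → toℕ (α⁺ ⟨$⟩ʳ embed x<n) ≡ valℕ α x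
    α⁺-embed {x} x<n = begin
      toℕ (α⁺ ⟨$⟩ʳ embed x<n)      ≡⟨ cong-α⁺ (embed≡inject₁ x<n) ⟩
      toℕ (α⁺ ⟨$⟩ʳ inject₁ X)      ≡⟨ cong-α⁺ (punchIn-fromℕ n X) ⟨
      toℕ (α⁺ ⟨$⟩ʳ punchIn top X)  ≡⟨ cong toℕ (insert-punchIn top top α X) ⟩
      toℕ (punchIn top (α ⟨$⟩ʳ X)) ≡⟨ cong toℕ (punchIn-fromℕ n _) ⟩
      toℕ (inject₁ (α ⟨$⟩ʳ X))     ≡⟨ toℕ-inject₁ _ ⟩
      toℕ (α ⟨$⟩ʳ X)               ≡⟨ valℕ-fromℕ< α x<n ⟨
      valℕ α x                     ∎
      where
      open ≡-Reasoning
      X = fromℕ< x<n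

    θ-k : valℕ θ k ≡ n
    θ-k = begin
      valℕ θ k                     ≡⟨ valℕ-θ (m<n⇒m<1+n k<n) ⟩
      toℕ (α⁺ ⟨$⟩ʳ swap K)         ≡⟨ cong-α⁺ (transpose-ˡ K top) ⟩
      toℕ (α⁺ ⟨$⟩ʳ top)            ≡⟨ cong toℕ α⁺-top ⟩
      toℕ top                      ≡⟨ toℕ-fromℕ n ⟩
      n                            ∎
      where open ≡-Reasoning

    θ-top : valℕ θ n ≡ valℕ α k
    θ-top = begin
      valℕ θ n                                ≡⟨ valℕ-θ (n<1+n n) ⟩
      toℕ (α⁺ ⟨$⟩ʳ swap (fromℕ< (n<1+n n)))   ≡⟨ cong-α⁺ (cong swap n≡top) ⟩
      toℕ (α⁺ ⟨$⟩ʳ swap top)                  ≡⟨ cong-α⁺ (transpose-ʳ K top) ⟩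
      toℕ (α⁺ ⟨$⟩ʳ K)                         ≡⟨ α⁺-embed k<n ⟩
      valℕ α k                                ∎
      where open ≡-Reasoning

    θ-α : ∀ {x} → x < n → x ≢ k → valℕ θ x ≡ valℕ α x
    θ-α {x} x<n x≢k = begin
      valℕ θ x                     ≡⟨ valℕ-θ (m<n⇒m<1+n x<n) ⟩
      toℕ (α⁺ ⟨$⟩ʳ swap (embed x<n)) ≡⟨ cong-α⁺ (transpose-≢ K top x≢K (embed≢top x<n)) ⟩
      toℕ (α⁺ ⟨$⟩ʳ embed x<n)      ≡⟨ α⁺-embed x<n ⟩
      valℕ α x                     ∎
      where
      open ≡-Reasoning
      x≢K : embed x<n ≢ K
      x≢K eq = x≢k (fromℕ<-injective _ _ _ _ eq)

  insertTop : ∃ (InsertsTop k α)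
  insertTop = θ , record { k<n = k<n ; θ-k = θ-k ; θ-top = θ-top ; θ-α = θ-α }

module _ {n} (α : Permutation′ n) {k} (k<n : k < n) where

  rlMin-split : ∀ v → IsRLMinValue (α ⟨$⟩ˡ_) v ⇔
    (v ∈ lrMaxima (valℕ α) k ⊎ v ∈ filter (k ≤?_) (lrMaxima (valℕ α) n))
  rlMin-split v = mk⇔ sound complete
    where
    sound : IsRLMinValue (α ⟨$⟩ˡ_) v →
            v ∈ lrMaxima (valℕ α) k ⊎ v ∈ filter (k ≤?_) (lrMaxima (valℕ α) n)
    sound rlMin with to (rlMin⇔lrMax α v) rlMin | v <? k
    ... | _   , L | yes v<k = inj₁ (from (∈-lrMaxima (valℕ α) k) (v<k , L))
    ... | v<n , L | no  v≮k =
      inj₂ (∈-filter⁺ (k ≤?_) (from (∈-lrMaxima (valℕ α) n) (v<n , L)) (≮⇒≥ v≮k))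

    complete : v ∈ lrMaxima (valℕ α) k ⊎ v ∈ filter (k ≤?_) (lrMaxima (valℕ α) n) →
               IsRLMinValue (α ⟨$⟩ˡ_) v
    complete (inj₁ v∈Is) with to (∈-lrMaxima (valℕ α) k) v∈Is
    ... | v<k , L = from (rlMin⇔lrMax α v) (<-trans v<k k<n , L)
    complete (inj₂ v∈S) =
      from (rlMin⇔lrMax α v) (to (∈-lrMaxima (valℕ α) n) (proj₁ (∈-filter⁻ (k ≤?_) v∈S)))

  rlMin-below : ∀ {Is S} → All (λ s → k ≤ s × s < n) S →
    (∀ v → IsRLMinValue (α ⟨$⟩ˡ_) v ⇔ (v ∈ Is ⊎ v ∈ S)) →
    ∀ {j} → j < k → j ∈ Is ⇔ LeftToRightMax (valℕ α) j
  rlMin-below {Is} {S} S-above rlMin⇔ {j} j<k = mk⇔ sound complete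
    where
    sound : j ∈ Is → LeftToRightMax (valℕ α) j
    sound j∈Is = proj₂ (to (rlMin⇔lrMax α j) (from (rlMin⇔ j) (inj₁ j∈Is)))

    complete : LeftToRightMax (valℕ α) j → j ∈ Is
    complete L with to (rlMin⇔ j) (from (rlMin⇔lrMax α j) (<-trans j<k k<n , L))
    ... | inj₁ j∈Is = j∈Is
    ... | inj₂ j∈S  = ⊥-elim (<⇒≱ j<k (proj₁ (All.lookup S-above j∈S)))

conditions-necessary : ∀ {n} {σ α : Permutation′ n} {θ : Permutation′ (suc n)} → 1 ≤ n →
  Indecomposable θ → ΨEq θ σ α → Conditions σ α
conditions-necessary {n} {σ} {α} {θ} 1≤n indecomposable (Ψσ≡σ , Ψα≡α) =
  Is , k , lrMaxima-linked (valℕ α) k , lrMaxima-head (valℕ α) k , k<n , σ-blocks ,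
  S , All.tabulate S-above , λ v → to (rlMin-split α k<n v) , from (rlMin-split α k<n v)
  where
  k : ℕ
  k = toℕ (θ ⟨$⟩ˡ fromℕ n)

  ins : InsertsTop k α θ
  ins = Ψα⇒insertsTop 1≤n indecomposable Ψα≡α
  open InsertsTop ins using (k<n)

  Is S : List ℕ
  Is = lrMaxima (valℕ α) k
  S = filter (k ≤?_) (lrMaxima (valℕ α) n)

  Is⇔ : ∀ {j} → j < k → j ∈ Is ⇔ LeftToRightMax (valℕ α) j
  Is⇔ j<k = mk⇔ (proj₂ ∘ to (∈-lrMaxima (valℕ α) k))
                (λ L → from (∈-lrMaxima (valℕ α) k) (j<k , L))

  σ-blocks : ∀ x → toℕ (σ ⟨$⟩ʳ x) ≡ consecCycles (memᵇ (Is ++ [ k ])) n (toℕ x)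
  σ-blocks x = trans (sym (Ψσ≡σ x))
    (Ψσ-insertsTop ins (All.tabulate (proj₁ ∘ to (∈-lrMaxima (valℕ α) k))) Is⇔ (toℕ<n x))

  S-above : ∀ {s} → s ∈ S → k ≤ s × s < n
  S-above s∈S with ∈-filter⁻ (k ≤?_) s∈S
  ... | s∈ , k≤s = k≤s , proj₁ (to (∈-lrMaxima (valℕ α) n) s∈)

conditions-sufficient : ∀ {n} {σ α : Permutation′ n} → IsHypermap σ α → Conditions σ α →
  ∃ λ (θ : Permutation′ (suc n)) → Indecomposable θ × ΨEq θ σ α
conditions-sufficient {n} {α = α} transitive
  (Is , k , sorted , _ , k<n , σ-blocks , S , S-above , rlMin⇔) =
  θ , insertsTop-indecomposable ins transitive (λ j<k → from (Is⇔ j<k)) σ-blocks ,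
  (λ x → trans (Ψσ-insertsTop ins Is<k Is⇔ (toℕ<n x)) (sym (σ-blocks x))) , insertsTop⇒Ψα ins
  where
  θ : Permutation′ (suc n)
  θ = proj₁ (insertTop α k<n)

  ins : InsertsTop k α θ
  ins = proj₂ (insertTop α k<n)

  Is<k : All (_< k) Is
  Is<k = sorted-last Is (Linked⇒AllPairs <-trans sorted)

  Is⇔ : ∀ {j} → j < k → j ∈ Is ⇔ LeftToRightMax (valℕ α) j
  Is⇔ = rlMin-below α k<n S-above (λ v → mk⇔ (proj₁ (rlMin⇔ v)) (proj₂ (rlMin⇔ v)))

lemma1 : (n : ℕ) → 1 ≤ n → (σ α : Permutation′ n) → IsHypermap σ α →
    (∃ λ (θ : Permutation′ (suc n)) → Indecomposable θ × ΨEq θ σ α) ⇔ Conditions σ α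
lemma1 n 1≤n σ α transitive = mk⇔
  (λ (θ , indecomposable , Ψθ≡σα) →
     conditions-necessary {σ = σ} {α} {θ} 1≤n indecomposable Ψθ≡σα)
  (conditions-sufficient transitive)
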